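{- Let $G$ be a graph with a 2-separation $G_1,G_2$, let $\{i,j\}=V(G_1)\cap V(G_2)$, and let $u,v\in V(G_1)$. Then \[ \mathcal{F}_{G}(u,v) = \mathcal{F}_{G_1}(u,v)\,\mathcal{F}_{G_2}(i,j) + \mathcal{F}_{G_1/ij}(u,v)\,T(G_2). \]
   Context: Graphs are finite and undirected; multiple edges are allowed, loops are not. $T(G)$ denotes the number of spanning trees of $G$. For vertices $u,v$ of $G$, $\mathcal{F}_G(u,v)$ denotes the number of spanning forests of $G$ with exactly two components in which $u$ and $v$ lie in different components. A 2-separation of $G$ is a pair of subgraphs $G_1,G_2$ such that $V(G)=V(G_1)\cup V(G_2)$, $|V(G_1)\cap V(G_2)|=2$, $E(G)=E(G_1)\cup E(G_2)$ and $E(G_1)\cap E(G_2)=\emptyset$. For vertices $i,j$ of a graph $H$, $H/ij$ is the graph obtained by identifying $i$ and $j$ into a single vertex called $ij$: every edge $\{x,i\}$ or $\{x,j\}$ with $x\neq i,j$ is replaced by an edge $\{x,ij\}$ (so a common neighbour of $i$ and $j$ gives a double edge to $ij$), edges not meeting $i$ or $j$ remain, and any edges between $i$ and $j$ disappear. In $\mathcal{F}_{G_1/ij}(u,v)$, if $u$ or $v$ equals $i$ or $j$ it is interpreted as the vertex $ij$. -}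

module Defs where

open import Data.Nat using (ℕ; zero; suc; _+_)
open import Data.Bool using (Bool; true; false; _∧_; _∨_; not; if_then_else_)
open import Data.Fin using (Fin; _≟_)
open import Data.Product using (_×_; _,_; proj₁; proj₂)
open import Data.List using (List; []; _∷_; map; allFin; length)
open import Data.Bool.ListAction using (all; any)
open import Data.Vec using (Vec; []; _∷_)
open import Relation.Nullary.Decidable using (⌊_⌋)
open import Function using (_∘_)

-- Edges are given as a list (so parallel edges are allowed); an edge is an
-- unordered pair, represented by an (arbitrarily oriented) ordered pair.
record Graph (n : ℕ) : Set where
  constructor mkGraph
  field
    V : Fin n → Bool
    E : List (Fin n × Fin n)
open Graph public

Edge : ℕ → Set
Edge n = Fin n × Fin n

_==_ : ∀ {n} → Fin n → Fin n → Bool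
x == y = ⌊ x ≟ y ⌋

select : ∀ {A : Set} (es : List A) → Vec Bool (length es) → List A
select []       []           = []
select (e ∷ es) (true ∷ bs)  = e ∷ select es bs
select (e ∷ es) (false ∷ bs) = select es bs

count : (m : ℕ) → (Vec Bool m → Bool) → ℕ
count zero    p = if p [] then 1 else 0
count (suc m) p = count m (p ∘ (true ∷_)) + count m (p ∘ (false ∷_))

step : ∀ {n} → List (Edge n) → (Fin n → Bool) → (Fin n → Bool)
step es R x = R x ∨ any (λ e → (R (proj₁ e) ∧ (proj₂ e == x)) ∨ (R (proj₂ e) ∧ (proj₁ e == x))) es

iter : ∀ {A : Set} → ℕ → (A → A) → A → A
iter zero    f a = a
iter (suc k) f a = f (iter k f a)

-- conn es u v : u and v are joined by a walk using edges of es
-- (n iterations of the closure suffice, as a path has < n edges)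
conn : ∀ {n} → List (Edge n) → Fin n → Fin n → Bool
conn {n} es u v = iter n (step es) (λ x → x == u) v

focus : ∀ {A : Set} → List A → List (A × List A)
focus []       = []
focus (x ∷ xs) = (x , xs) ∷ map (λ p → proj₁ p , (x ∷ proj₂ p)) (focus xs)

-- a set of edges is acyclic iff no edge lies on a cycle, i.e. for each edge
-- its endpoints are not joined by the remaining edges (this also rules out
-- 2-cycles formed by parallel edges)
acyclic : ∀ {n} → List (Edge n) → Bool
acyclic es = all (λ p → not (conn (proj₂ p) (proj₁ (proj₁ p)) (proj₂ (proj₁ p)))) (focus es)

allV : ∀ {n} → (Fin n → Bool) → Bool
allV {n} P = all P (allFin n)

isSpanningTree : ∀ {n} (H : Graph n) → List (Edge n) → Bool
isSpanningTree H es =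
  acyclic es ∧ allV (λ x → allV (λ y → not (V H x ∧ V H y) ∨ conn es x y))

isTwoForestSep : ∀ {n} (H : Graph n) → Fin n → Fin n → List (Edge n) → Bool
isTwoForestSep H u v es =
  acyclic es ∧ not (conn es u v) ∧ allV (λ x → not (V H x) ∨ conn es u x ∨ conn es v x)

T : ∀ {n} → Graph n → ℕ
T H = count (length (E H)) (isSpanningTree H ∘ select (E H))

𝓕 : ∀ {n} → Graph n → Fin n → Fin n → ℕ
𝓕 H u v = count (length (E H)) (isTwoForestSep H u v ∘ select (E H))

filterᵇ : ∀ {A : Set} → (A → Bool) → List A → List A
filterᵇ p []       = []
filterᵇ p (x ∷ xs) = if p x then x ∷ filterᵇ p xs else filterᵇ p xs

-- identification of j into i: the merged vertex ij is named i
ren : ∀ {n} → Fin n → Fin n → Fin n → Fin n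
ren i j x = if x == j then i else x

-- H / ij : vertex j removed (merged into i), endpoints j renamed to i,
-- edges between i and j (which would become loops) deleted
contract : ∀ {n} → Graph n → Fin n → Fin n → Graph n
contract H i j = mkGraph
  (λ x → V H x ∧ not (x == j))
  (map (λ e → ren i j (proj₁ e) , ren i j (proj₂ e))
       (filterᵇ (λ e → not (isIJ e)) (E H)))
  where
  isIJ : Edge _ → Bool
  isIJ e = ((proj₁ e == i) ∧ (proj₂ e == j)) ∨ ((proj₁ e == j) ∧ (proj₂ e == i))

module Submission where

-- A spanning forest F of G splits as F1 ++ F2 with F1 ⊆ E₁, F2 ⊆ E₂.  Since
-- the two sides meet only in {i, j}, F is a two-forest of G separating u and v
-- exactly when either F2 is a two-forest of G₂ separating i and j and F1 is a
-- two-forest of G₁ separating u and v, or F2 is a spanning tree of G₂ and F1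
-- avoids ij and contracts to a two-forest of G₁/ij separating u and v.  The
-- two cases are exclusive, so counting both sides gives the identity.

open import Defs
open import Data.Nat using (ℕ; zero; suc; _+_; _*_; _∸_; _≤_; z≤n; s≤s)
open import Data.Nat.Properties
  using (≤-trans; ≤-refl; ≤-reflexive; +-mono-≤; n≤1+n; <-irrefl; m≤n⇒m≤1+n; m∸n+n≡m; +-suc; m≤n+m; _≤?_; ≰⇒>;
         +-identityʳ; *-distribʳ-+; *-distribˡ-+; +-commutativeSemigroup)
open import Algebra.Properties.CommutativeSemigroup +-commutativeSemigroup using (interchange)
open import Data.Bool using (Bool; true; false; _∧_; _∨_; not; if_then_else_)
open import Data.Fin using (Fin; _≟_)
open import Data.Product using (_×_; _,_; proj₁; proj₂; Σ)
open import Data.Sum using (_⊎_; inj₁; inj₂; [_,_]′) renaming (map to ⊎-map)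
open import Function using (id; _∘′_)
open import Data.Empty using (⊥; ⊥-elim)
open import Data.Unit using (⊤; tt)
open import Data.List using (List; []; _∷_; [_]; _++_; map; allFin; length)
open import Data.List.Properties using (length-tabulate; ++-assoc)
open import Data.Bool.ListAction using (all; any)
open import Data.List.Membership.Propositional using (_∈_)
open import Data.List.Membership.Propositional.Properties using (∈-allFin; ∈-++⁻; ∈-map⁺; ∈-map⁻)
open import Data.List.Relation.Unary.Any using (here; there)
open import Data.List.Relation.Binary.Subset.Propositional using (_⊆_)
open import Data.List.Relation.Binary.Subset.Propositional.Properties
  using (⊆-reflexive-↭; xs⊆xs++ys; xs⊆ys++xs) renaming (++⁺ˡ to ⊆-++⁺ˡ)
open import Data.List.Relation.Binary.Permutation.Propositional as Perm
  using (_↭_; prep; swap; ↭-sym; ↭-trans; ↭-reflexive)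
open import Data.List.Relation.Binary.Permutation.Propositional.Properties using (shift; ++⁺ˡ; ++-comm)
open import Relation.Nullary using (¬_; yes; no)
open import Data.List.Relation.Unary.All as All using (All; []; _∷_)
open import Relation.Binary.PropositionalEquality using (_≡_; _≢_; refl; sym; trans; cong; cong₂; subst; module ≡-Reasoning)

∧-elim : ∀ {a b} → a ∧ b ≡ true → a ≡ true × b ≡ true
∧-elim {true} {true} _ = refl , refl

∧-intro : ∀ {a b} → a ≡ true → b ≡ true → a ∧ b ≡ true
∧-intro refl refl = refl

∨-elim : ∀ {a b} → a ∨ b ≡ true → a ≡ true ⊎ b ≡ true
∨-elim {true}  _ = inj₁ refl
∨-elim {false} p = inj₂ p

∨-introˡ : ∀ {a b} → a ≡ true → a ∨ b ≡ true
∨-introˡ refl = refl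

∨-introʳ : ∀ {a b} → b ≡ true → a ∨ b ≡ true
∨-introʳ {true}  _ = refl
∨-introʳ {false} p = p

not-elim : ∀ {a} → not a ≡ true → ¬ (a ≡ true)
not-elim {true} () _

not-intro : ∀ {a} → ¬ (a ≡ true) → not a ≡ true
not-intro {true}  p = ⊥-elim (p refl)
not-intro {false} _ = refl

bool-ext : ∀ {a b} → (a ≡ true → b ≡ true) → (b ≡ true → a ≡ true) → a ≡ b
bool-ext {true}          f _ = sym (f refl)
bool-ext {false} {true}  _ g = g refl
bool-ext {false} {false} _ _ = refl

==⇒≡ : ∀ {n} {x y : Fin n} → (x == y) ≡ true → x ≡ y
==⇒≡ {x = x} {y} p with x ≟ y
... | yes q = q

≡⇒== : ∀ {n} {x y : Fin n} → x ≡ y → (x == y) ≡ true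
≡⇒== {x = x} {y} p with x ≟ y
... | yes _ = refl
... | no q  = ⊥-elim (q p)

≢⇒== : ∀ {n} {x y : Fin n} → x ≢ y → (x == y) ≡ false
≢⇒== {x = x} {y} p with x ≟ y
... | yes q = ⊥-elim (p q)
... | no _  = refl

module _ {A : Set} (p : A → Bool) where

  any-elim : ∀ xs → any p xs ≡ true → Σ A λ x → x ∈ xs × p x ≡ true
  any-elim (x ∷ xs) q with ∨-elim {p x} q
  ... | inj₁ r = x , here refl , r
  ... | inj₂ r with any-elim xs r
  ... | y , m , s = y , there m , s

  any-intro : ∀ {xs x} → x ∈ xs → p x ≡ true → any p xs ≡ true
  any-intro (here refl) q = ∨-introˡ q
  any-intro {y ∷ _} (there m) q = ∨-introʳ {p y} (any-intro m q)

  all-elim : ∀ xs → all p xs ≡ true → ∀ {x} → x ∈ xs → p x ≡ true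
  all-elim (x ∷ xs) q (here refl) = proj₁ (∧-elim q)
  all-elim (x ∷ xs) q (there m)   = all-elim xs (proj₂ (∧-elim {p x} q)) m

  all-intro : ∀ xs → (∀ {x} → x ∈ xs → p x ≡ true) → all p xs ≡ true
  all-intro []       _ = refl
  all-intro (x ∷ xs) f = ∧-intro (f (here refl)) (all-intro xs (λ m → f (there m)))

any-cong : ∀ {A : Set} {p q : A → Bool} → (∀ x → p x ≡ q x) → ∀ xs → any p xs ≡ any q xs
any-cong f []       = refl
any-cong f (x ∷ xs) rewrite f x | any-cong f xs = refl

all-cong : ∀ {A : Set} {p q : A → Bool} → (∀ x → p x ≡ q x) → ∀ xs → all p xs ≡ all q xs
all-cong f []       = refl
all-cong f (x ∷ xs) rewrite f x | all-cong f xs = refl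

all-map : ∀ {A B : Set} (p : B → Bool) (h : A → B) xs → all p (map h xs) ≡ all (λ x → p (h x)) xs
all-map p h []       = refl
all-map p h (x ∷ xs) = cong (p (h x) ∧_) (all-map p h xs)

allV-elim : ∀ {n} (P : Fin n → Bool) → allV P ≡ true → ∀ x → P x ≡ true
allV-elim {n} P q x = all-elim P (allFin n) q (∈-allFin x)

allV-intro : ∀ {n} (P : Fin n → Bool) → (∀ x → P x ≡ true) → allV P ≡ true
allV-intro {n} P f = all-intro P (allFin n) (λ {x} _ → f x)

module _ {n : ℕ} where

  Joins : Edge n → Fin n → Fin n → Set
  Joins e a c = (proj₁ e ≡ a × proj₂ e ≡ c) ⊎ (proj₂ e ≡ a × proj₁ e ≡ c)

  data Walk (R : List (Edge n)) : Fin n → Fin n → Set where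
    nil  : ∀ {a} → Walk R a a
    cons : ∀ {a c b} (e : Edge n) → e ∈ R → Joins e a c → Walk R c b → Walk R a b

  Joined : List (Edge n) → Edge n → Set
  Joined R e = Walk R (proj₁ e) (proj₂ e)

  forward : ∀ {e : Edge n} → Joins e (proj₁ e) (proj₂ e)
  forward = inj₁ (refl , refl)

  Joins-sym : ∀ {e a c} → Joins e a c → Joins e c a
  Joins-sym (inj₁ (p , q)) = inj₂ (q , p)
  Joins-sym (inj₂ (p , q)) = inj₁ (q , p)

  Walk-mono : ∀ {R R' a b} → R ⊆ R' → Walk R a b → Walk R' a b
  Walk-mono s nil             = nil
  Walk-mono s (cons e m ad w) = cons e (s m) ad (Walk-mono s w)

  Walk-trans : ∀ {R a b c} → Walk R a b → Walk R b c → Walk R a c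
  Walk-trans nil              w = w
  Walk-trans (cons e m ad w₁) w = cons e m ad (Walk-trans w₁ w)

  edgeWalk : ∀ {R e a c} → e ∈ R → Joins e a c → Walk R a c
  edgeWalk {e = e} m ad = cons e m ad nil

  Walk-sym : ∀ {R a b} → Walk R a b → Walk R b a
  Walk-sym nil             = nil
  Walk-sym (cons e m ad w) = Walk-trans (Walk-sym w) (edgeWalk m (Joins-sym ad))

  Walk-[] : ∀ {a b} → Walk [] a b → a ≡ b
  Walk-[] nil = refl

  Via : List (Edge n) → Edge n → Fin n → Fin n → Set
  Via R x a b = (Walk R a (proj₁ x) × Walk R (proj₂ x) b) ⊎ (Walk R a (proj₂ x) × Walk R (proj₁ x) b)

  walk-cases : ∀ {x R a b} → Walk (x ∷ R) a b → Walk R a b ⊎ Via R x a b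
  walk-cases nil = inj₁ nil
  walk-cases (cons e (there m) ad w) with walk-cases w
  ... | inj₁ r                = inj₁ (cons e m ad r)
  ... | inj₂ (inj₁ (r , s))   = inj₂ (inj₁ (cons e m ad r , s))
  ... | inj₂ (inj₂ (r , s))   = inj₂ (inj₂ (cons e m ad r , s))
  walk-cases (cons e (here refl) (inj₁ (refl , refl)) w) with walk-cases w
  ... | inj₁ r                = inj₂ (inj₁ (nil , r))
  ... | inj₂ (inj₁ (_ , s))   = inj₂ (inj₁ (nil , s))
  ... | inj₂ (inj₂ (_ , s))   = inj₁ s
  walk-cases (cons e (here refl) (inj₂ (refl , refl)) w) with walk-cases w
  ... | inj₁ r                = inj₂ (inj₂ (nil , r))
  ... | inj₂ (inj₁ (_ , s))   = inj₁ s
  ... | inj₂ (inj₂ (_ , s))   = inj₂ (inj₂ (nil , s))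

  bypass : ∀ {x A B a b} → Walk (x ∷ A) a b → Joined B x → A ⊆ B → Walk B a b
  bypass w jx s with walk-cases w
  ... | inj₁ q                = Walk-mono s q
  ... | inj₂ (inj₁ (p , q))   = Walk-trans (Walk-mono s p) (Walk-trans jx (Walk-mono s q))
  ... | inj₂ (inj₂ (p , q))   = Walk-trans (Walk-mono s p) (Walk-trans (Walk-sym jx) (Walk-mono s q))

  -- Exchange: if y is a bridge of es but closes a cycle once x is added, then
  -- x closes a cycle in y ∷ es (the cycle through x and y).
  exchange : ∀ {x y es} → ¬ Joined es y → Joined (x ∷ es) y → Joined (y ∷ es) x
  exchange ny r with walk-cases r
  ... | inj₁ r'               = ⊥-elim (ny r')
  ... | inj₂ (inj₁ (p , q))   =
    Walk-trans (Walk-mono there (Walk-sym p))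
      (Walk-trans (edgeWalk (here refl) forward) (Walk-mono there (Walk-sym q)))
  ... | inj₂ (inj₂ (p , q))   =
    Walk-trans (Walk-mono there q)
      (Walk-trans (edgeWalk (here refl) (Joins-sym forward)) (Walk-mono there p))

  Within : (Fin n → Bool) → List (Edge n) → Set
  Within V R = ∀ {e} → e ∈ R → V (proj₁ e) ≡ true × V (proj₂ e) ≡ true

  Joins-within : ∀ {V : Fin n → Bool} {e a c} →
                 V (proj₁ e) ≡ true × V (proj₂ e) ≡ true → Joins e a c → V a ≡ true
  Joins-within (p , _) (inj₁ (refl , refl)) = p
  Joins-within (_ , q) (inj₂ (refl , refl)) = q

-- The stages increase, and while they keep growing stage k has
-- more than k elements; as there are only n vertices they are stable by stage
-- n, and a stable stage is closed along edges, so it contains every vertex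
-- reachable from u (completeness).

size : ∀ {n} → List (Fin n) → (Fin n → Bool) → ℕ
size []      R = 0
size (x ∷ L) R = (if R x then 1 else 0) + size L R

module _ {n : ℕ} where

  size≤length : ∀ (L : List (Fin n)) R → size L R ≤ length L
  size≤length []      R = z≤n
  size≤length (x ∷ L) R with R x
  ... | true  = s≤s (size≤length L R)
  ... | false = m≤n⇒m≤1+n (size≤length L R)

  indicator-mono : ∀ {a b} → (a ≡ true → b ≡ true) → (if a then 1 else 0) ≤ (if b then 1 else 0)
  indicator-mono {true}          f rewrite f refl = ≤-refl
  indicator-mono {false} {true}  _ = z≤n
  indicator-mono {false} {false} _ = z≤n

  size-mono : ∀ (L : List (Fin n)) {R R'} → (∀ x → R x ≡ true → R' x ≡ true) → size L R ≤ size L R'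
  size-mono []      f = z≤n
  size-mono (x ∷ L) f = +-mono-≤ (indicator-mono (f x)) (size-mono L f)

  size-strict : ∀ (L : List (Fin n)) {R R'} → (∀ x → R x ≡ true → R' x ≡ true) →
                ∀ {x} → x ∈ L → R x ≡ false → R' x ≡ true → suc (size L R) ≤ size L R'
  size-strict (x ∷ L) f (here refl) p q rewrite p | q = s≤s (size-mono L f)
  size-strict (y ∷ L) {R} f (there m) p q =
    ≤-trans (≤-reflexive (sym (+-suc (if R y then 1 else 0) (size L R))))
            (+-mono-≤ (indicator-mono (f y)) (size-strict L f m p q))

  size-pos : ∀ (L : List (Fin n)) R {x} → x ∈ L → R x ≡ true → 1 ≤ size L R
  size-pos (x ∷ L) R (here refl) p rewrite p = s≤s z≤n
  size-pos (y ∷ L) R (there m)   p = ≤-trans (size-pos L R m p) (m≤n+m (size L R) _)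

  size-squeeze : ∀ (L : List (Fin n)) {R R'} → (∀ x → R x ≡ true → R' x ≡ true) →
                 size L R' ≤ size L R → ∀ {x} → x ∈ L → R' x ≡ true → R x ≡ true
  size-squeeze L {R} f le {x} m q with R x in eq
  ... | true  = refl
  ... | false = ⊥-elim (<-irrefl refl (≤-trans (size-strict L f m eq q) le))

module _ {n : ℕ} (es : List (Edge n)) (u : Fin n) where

  stage : ℕ → Fin n → Bool
  stage k = iter k (step es) (λ x → x == u)

  stage-sound : ∀ k x → stage k x ≡ true → Walk es u x
  stage-sound zero    x p = subst (Walk es u) (sym (==⇒≡ p)) nil
  stage-sound (suc k) x p with ∨-elim {stage k x} p
  ... | inj₁ q = stage-sound k x q
  ... | inj₂ q with any-elim _ es q
  ... | e , m , r with ∨-elim r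
  ... | inj₁ s = Walk-trans (stage-sound k _ (proj₁ (∧-elim s)))
                            (edgeWalk m (inj₁ (refl , ==⇒≡ (proj₂ (∧-elim s)))))
  ... | inj₂ s = Walk-trans (stage-sound k _ (proj₁ (∧-elim s)))
                            (edgeWalk m (inj₂ (refl , ==⇒≡ (proj₂ (∧-elim {stage k (proj₂ e)} s)))))

  stage-mono : ∀ k x → stage k x ≡ true → stage (suc k) x ≡ true
  stage-mono k x = ∨-introˡ

  stage-u : ∀ k → stage k u ≡ true
  stage-u zero    = ≡⇒== refl
  stage-u (suc k) = stage-mono k u (stage-u k)

  step-cong : ∀ {R R' : Fin n → Bool} → (∀ y → R y ≡ R' y) → ∀ x → step es R x ≡ step es R' x
  step-cong {R} {R'} f x rewrite f x =
    cong (R' x ∨_) (any-cong (λ e → joinIf (f (proj₁ e)) (f (proj₂ e))) es)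
    where
    joinIf : ∀ {a a' b b' c d : Bool} → a ≡ a' → b ≡ b' → (a ∧ c) ∨ (b ∧ d) ≡ (a' ∧ c) ∨ (b' ∧ d)
    joinIf refl refl = refl

  Stable : ℕ → Set
  Stable k = ∀ x → stage (suc k) x ≡ stage k x

  stable-≤ : ∀ {k m} → k ≤ m → Stable k → Stable m
  stable-≤ {k} {m} le st = subst Stable (m∸n+n≡m le) (stable-+ (m ∸ k))
    where
    stable-+ : ∀ d → Stable (d + k)
    stable-+ zero    = st
    stable-+ (suc d) = step-cong (stable-+ d)

  stable-closed : ∀ {k} → Stable k → ∀ {a b} → stage k a ≡ true → Walk es a b → stage k b ≡ true
  stable-closed st p nil = p
  stable-closed {k} st p (cons e m ad w) = stable-closed {k} st (closed p m ad) w
    where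
    closed : ∀ {y z e} → stage k y ≡ true → e ∈ es → Joins e y z → stage k z ≡ true
    closed {z = z} {e} p m (inj₁ (refl , refl)) =
      trans (sym (st z)) (∨-introʳ {stage k z} (any-intro _ m (∨-introˡ (∧-intro p (≡⇒== refl)))))
    closed {z = z} {e} p m (inj₂ (refl , refl)) =
      trans (sym (st z)) (∨-introʳ {stage k z}
        (any-intro _ m (∨-introʳ {stage k (proj₁ e) ∧ (proj₂ e == z)} (∧-intro p (≡⇒== refl)))))

  stageSize : ℕ → ℕ
  stageSize k = size (allFin n) (stage k)

  growth : ∀ k → (Σ ℕ λ m → m ≤ k × Stable m) ⊎ (suc k ≤ stageSize k)
  growth zero = inj₂ (size-pos (allFin n) (stage 0) (∈-allFin u) (stage-u 0))
  growth (suc k) with growth k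
  ... | inj₁ (m , le , st) = inj₁ (m , m≤n⇒m≤1+n le , st)
  ... | inj₂ h with stageSize (suc k) ≤? stageSize k
  ... | yes le = inj₁ (k , n≤1+n k , λ x → bool-ext
                   (size-squeeze (allFin n) (stage-mono k) le (∈-allFin x)) (stage-mono k x))
  ... | no nle = inj₂ (≤-trans (s≤s h) (≰⇒> nle))

  stable-n : Stable n
  stable-n with growth n
  ... | inj₁ (m , le , st) = stable-≤ le st
  ... | inj₂ h = ⊥-elim (<-irrefl refl (≤-trans h (≤-trans (size≤length (allFin n) (stage n))
                   (≤-reflexive (length-tabulate (λ x → x))))))

  conn-complete : ∀ {x} → Walk es u x → conn es u x ≡ true
  conn-complete = stable-closed {n} stable-n (stage-u n)

  conn-sound : ∀ {x} → conn es u x ≡ true → Walk es u x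
  conn-sound {x} = stage-sound n x

-- Forests.  'Forest es' says that every edge of es is a bridge of the edges
-- after it, which is convenient for induction.  The Boolean 'acyclic es'
-- instead demands that every edge be a bridge of all the other edges.  The two
-- agree: 'Bridges C es' interpolates between them (C holds the edges already
-- visited), and the exchange lemma moves a visited edge into C.

module _ {n : ℕ} where

  Forest : List (Edge n) → Set
  Forest []       = ⊤
  Forest (x ∷ xs) = ¬ Joined xs x × Forest xs

  Bridges : List (Edge n) → List (Edge n) → Set
  Bridges C []       = ⊤
  Bridges C (x ∷ xs) = ¬ Joined (C ++ xs) x × Bridges (C ++ [ x ]) xs

  bridges? : List (Edge n) → List (Edge n) → Bool
  bridges? C es = all (λ p → not (conn (C ++ proj₂ p) (proj₁ (proj₁ p)) (proj₂ (proj₁ p)))) (focus es)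

  bridges?-∷ : ∀ C x xs → bridges? C (x ∷ xs) ≡ not (conn (C ++ xs) (proj₁ x) (proj₂ x)) ∧ bridges? (C ++ [ x ]) xs
  bridges?-∷ C x xs = cong (not (conn (C ++ xs) (proj₁ x) (proj₂ x)) ∧_)
    (trans (all-map _ _ (focus xs))
      (all-cong (λ p → cong (λ L → not (conn L (proj₁ (proj₁ p)) (proj₂ (proj₁ p))))
                             (sym (++-assoc C [ x ] (proj₂ p))))
                (focus xs)))

  not-conn⇒bridge : ∀ {R : List (Edge n)} {x} → not (conn R (proj₁ x) (proj₂ x)) ≡ true → ¬ Joined R x
  not-conn⇒bridge {R} {x} p r = not-elim p (conn-complete R (proj₁ x) r)

  bridge⇒not-conn : ∀ {R : List (Edge n)} {x} → ¬ Joined R x → not (conn R (proj₁ x) (proj₂ x)) ≡ true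
  bridge⇒not-conn {R} {x} nr = not-intro (λ c → nr (conn-sound R (proj₁ x) c))

  bridges?-sound : ∀ C es → bridges? C es ≡ true → Bridges C es
  bridges?-sound C []       _ = tt
  bridges?-sound C (x ∷ xs) p with ∧-elim (trans (sym (bridges?-∷ C x xs)) p)
  ... | a , b = not-conn⇒bridge a , bridges?-sound (C ++ [ x ]) xs b

  bridges?-complete : ∀ C es → Bridges C es → bridges? C es ≡ true
  bridges?-complete C []       _       = refl
  bridges?-complete C (x ∷ xs) (a , b) =
    trans (bridges?-∷ C x xs) (∧-intro (bridge⇒not-conn a) (bridges?-complete (C ++ [ x ]) xs b))

  Bridges-anti : ∀ {C D} es → C ⊆ D → Bridges D es → Bridges C es
  Bridges-anti []       _ _       = tt
  Bridges-anti (x ∷ xs) s (a , b) =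
    (λ r → a (Walk-mono (⊆-++⁺ˡ xs s) r)) , Bridges-anti xs (⊆-++⁺ˡ [ x ] s) b

  Bridges-visit : ∀ C x xs → ¬ Joined (C ++ xs) x → Bridges C xs → Bridges (C ++ [ x ]) xs
  Bridges-visit C x []       _  _        = tt
  Bridges-visit C x (y ∷ ys) nx (ny , p) =
    (λ r → nx (Walk-mono (⊆-reflexive-↭ (↭-sym (shift y C ys)))
                 (exchange ny (Walk-mono (⊆-reflexive-↭ (xC++ys x)) r)))) ,
    Bridges-anti ys (⊆-reflexive-↭ swapLast)
      (Bridges-visit (C ++ [ y ]) x ys (λ r → nx (Walk-mono (⊆-reflexive-↭ (assoc y)) r)) p)
    where
    assoc : ∀ z → (C ++ [ z ]) ++ ys ↭ C ++ z ∷ ys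
    assoc z = ↭-reflexive (++-assoc C [ z ] ys)
    xC++ys : ∀ z → (C ++ [ z ]) ++ ys ↭ z ∷ C ++ ys
    xC++ys z = ↭-trans (assoc z) (shift z C ys)
    swapLast : (C ++ [ x ]) ++ [ y ] ↭ (C ++ [ y ]) ++ [ x ]
    swapLast = ↭-trans (↭-reflexive (++-assoc C [ x ] [ y ]))
                 (↭-trans (++⁺ˡ C (swap x y Perm.refl)) (↭-sym (↭-reflexive (++-assoc C [ y ] [ x ]))))

  Bridges⇒Forest : ∀ es → Bridges [] es → Forest es
  Bridges⇒Forest []       _       = tt
  Bridges⇒Forest (x ∷ xs) (a , b) = a , Bridges⇒Forest xs (Bridges-anti xs (λ ()) b)

  Forest⇒Bridges : ∀ es → Forest es → Bridges [] es
  Forest⇒Bridges []       _       = tt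
  Forest⇒Bridges (x ∷ xs) (a , b) = a , Bridges-visit [] x xs a (Forest⇒Bridges xs b)

  acyclic-sound : ∀ es → acyclic es ≡ true → Forest es
  acyclic-sound es p = Bridges⇒Forest es (bridges?-sound [] es p)

  acyclic-complete : ∀ es → Forest es → acyclic es ≡ true
  acyclic-complete es p = bridges?-complete [] es (Forest⇒Bridges es p)

  Forest-↭ : ∀ {xs ys} → xs ↭ ys → Forest xs → Forest ys
  Forest-↭ Perm.refl a = a
  Forest-↭ (prep x p) (a , b) = (λ r → a (Walk-mono (⊆-reflexive-↭ (↭-sym p)) r)) , Forest-↭ p b
  Forest-↭ (swap x y p) (a , b , c) =
    (λ r → a (exchange b (Walk-mono (⊆-reflexive-↭ (prep x (↭-sym p))) r))) ,
    (λ r → a (Walk-mono (λ m → there (⊆-reflexive-↭ (↭-sym p) m)) r)) ,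
    Forest-↭ p c
  Forest-↭ (Perm.trans p q) a = Forest-↭ q (Forest-↭ p a)

module _ {n : ℕ} where

  TwoForest : (Fin n → Bool) → List (Edge n) → Fin n → Fin n → Set
  TwoForest V R u v = Forest R × ¬ Walk R u v × (∀ x → V x ≡ true → Walk R u x ⊎ Walk R v x)

  SpanningTree : (Fin n → Bool) → List (Edge n) → Set
  SpanningTree V R = Forest R × (∀ x y → V x ≡ true → V y ≡ true → Walk R x y)

  twoForest-sound : ∀ (H : Graph n) u v es → isTwoForestSep H u v es ≡ true → TwoForest (V H) es u v
  twoForest-sound H u v es p with ∧-elim {acyclic es} p
  ... | a , q with ∧-elim {not (conn es u v)} q
  ... | b , c = acyclic-sound es a , (λ r → not-elim b (conn-complete es u r)) , covered
    where
    covered : ∀ x → V H x ≡ true → Walk es u x ⊎ Walk es v x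
    covered x vx with ∨-elim {not (V H x)} (allV-elim (λ x → not (V H x) ∨ conn es u x ∨ conn es v x) c x)
    ... | inj₁ nv = ⊥-elim (not-elim nv vx)
    ... | inj₂ d with ∨-elim d
    ... | inj₁ r = inj₁ (conn-sound es u r)
    ... | inj₂ r = inj₂ (conn-sound es v r)

  twoForest-complete : ∀ (H : Graph n) u v es → TwoForest (V H) es u v → isTwoForestSep H u v es ≡ true
  twoForest-complete H u v es (a , b , c) =
    ∧-intro (acyclic-complete es a) (∧-intro (not-intro (λ q → b (conn-sound es u q))) (allV-intro _ covered))
    where
    covered : ∀ x → (not (V H x) ∨ conn es u x ∨ conn es v x) ≡ true
    covered x with V H x in eq
    ... | false = refl
    ... | true with c x eq
    ... | inj₁ r = ∨-introˡ (conn-complete es u r)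
    ... | inj₂ r = ∨-introʳ {conn es u x} (conn-complete es v r)

  spanningTree-sound : ∀ (H : Graph n) es → isSpanningTree H es ≡ true → SpanningTree (V H) es
  spanningTree-sound H es p with ∧-elim {acyclic es} p
  ... | a , c = acyclic-sound es a , connected
    where
    connected : ∀ x y → V H x ≡ true → V H y ≡ true → Walk es x y
    connected x y vx vy with ∨-elim {not (V H x ∧ V H y)}
        (allV-elim _ (allV-elim (λ x → allV (λ y → not (V H x ∧ V H y) ∨ conn es x y)) c x) y)
    ... | inj₁ nv = ⊥-elim (not-elim nv (∧-intro vx vy))
    ... | inj₂ r  = conn-sound es x r

  spanningTree-complete : ∀ (H : Graph n) es → SpanningTree (V H) es → isSpanningTree H es ≡ true
  spanningTree-complete H es (a , c) =
    ∧-intro (acyclic-complete es a) (allV-intro _ (λ x → allV-intro _ (λ y → connected x y)))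
    where
    connected : ∀ x y → (not (V H x ∧ V H y) ∨ conn es x y) ≡ true
    connected x y with V H x in ex | V H y in ey
    ... | false | _     = refl
    ... | true  | false = refl
    ... | true  | true  = conn-complete es x (c x y ex ey)

  twoForest-not-tree : ∀ {V R x y} → V x ≡ true → V y ≡ true → TwoForest V R x y → SpanningTree V R → ⊥
  twoForest-not-tree vx vy (_ , x≁y , _) (_ , connected) = x≁y (connected _ _ vx vy)

  isTwoForestSep-↭ : ∀ (H : Graph n) u v {F F'} → F ↭ F' → isTwoForestSep H u v F ≡ isTwoForestSep H u v F'
  isTwoForestSep-↭ H u v {F} {F'} p =
    bool-ext (λ q → twoForest-complete H u v F' (transport p (twoForest-sound H u v F q)))
             (λ q → twoForest-complete H u v F (transport (↭-sym p) (twoForest-sound H u v F' q)))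
    where
    transport : ∀ {A B} → A ↭ B → TwoForest (V H) A u v → TwoForest (V H) B u v
    transport p (a , b , c) =
      Forest-↭ p a , (λ r → b (Walk-mono (⊆-reflexive-↭ (↭-sym p)) r)) ,
      (λ x vx → ⊎-map (Walk-mono (⊆-reflexive-↭ p)) (Walk-mono (⊆-reflexive-↭ p)) (c x vx))

ind : Bool → ℕ
ind b = if b then 1 else 0

ind-∧ : ∀ a b → ind (a ∧ b) ≡ ind a * ind b
ind-∧ true  b = sym (+-identityʳ (ind b))
ind-∧ false b = refl

ind-∨ : ∀ {a b} → (a ≡ true → b ≡ true → ⊥) → ind (a ∨ b) ≡ ind a + ind b
ind-∨ {true}  {true}  excl = ⊥-elim (excl refl refl)
ind-∨ {true}  {false} _    = refl
ind-∨ {false}         _    = refl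

module _ {A : Set} where

  ΣSub : List A → (List A → ℕ) → ℕ
  ΣSub []       g = g []
  ΣSub (e ∷ es) g = ΣSub es (λ F → g (e ∷ F)) + ΣSub es g

  count-ΣSub : ∀ es (Q : List A → Bool) → count (length es) (λ bs → Q (select es bs)) ≡ ΣSub es (λ F → ind (Q F))
  count-ΣSub []       Q = refl
  count-ΣSub (e ∷ es) Q = cong₂ _+_ (count-ΣSub es (λ F → Q (e ∷ F))) (count-ΣSub es Q)

  ΣSub-cong : ∀ es {g h : List A → ℕ} → (∀ F → g F ≡ h F) → ΣSub es g ≡ ΣSub es h
  ΣSub-cong []       f = f []
  ΣSub-cong (e ∷ es) f = cong₂ _+_ (ΣSub-cong es (λ F → f (e ∷ F))) (ΣSub-cong es f)

  ΣSub-congAll : ∀ {Q : A → Set} {es} {g h : List A → ℕ} →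
                 (∀ F → All Q F → g F ≡ h F) → All Q es → ΣSub es g ≡ ΣSub es h
  ΣSub-congAll f []       = f [] []
  ΣSub-congAll f (q ∷ qs) =
    cong₂ _+_ (ΣSub-congAll (λ F qF → f (_ ∷ F) (q ∷ qF)) qs) (ΣSub-congAll f qs)

  ΣSub-++ : ∀ xs ys (g : List A → ℕ) → ΣSub (xs ++ ys) g ≡ ΣSub xs (λ F₁ → ΣSub ys (λ F₂ → g (F₁ ++ F₂)))
  ΣSub-++ []       ys g = refl
  ΣSub-++ (x ∷ xs) ys g = cong₂ _+_ (ΣSub-++ xs ys (λ F → g (x ∷ F))) (ΣSub-++ xs ys g)

  ΣSub-zero : ∀ es → ΣSub es (λ _ → 0) ≡ 0
  ΣSub-zero []                        = refl
  ΣSub-zero (e ∷ es) rewrite ΣSub-zero es = refl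

  ΣSub-+ : ∀ es (g h : List A → ℕ) → ΣSub es (λ F → g F + h F) ≡ ΣSub es g + ΣSub es h
  ΣSub-+ []       g h = refl
  ΣSub-+ (e ∷ es) g h
    rewrite ΣSub-+ es (λ F → g (e ∷ F)) (λ F → h (e ∷ F)) | ΣSub-+ es g h =
      interchange (ΣSub es (λ F → g (e ∷ F))) (ΣSub es (λ F → h (e ∷ F))) (ΣSub es g) (ΣSub es h)

  ΣSub-*ʳ : ∀ es (g : List A → ℕ) c → ΣSub es (λ F → g F * c) ≡ ΣSub es g * c
  ΣSub-*ʳ []       g c = refl
  ΣSub-*ʳ (e ∷ es) g c rewrite ΣSub-*ʳ es (λ F → g (e ∷ F)) c | ΣSub-*ʳ es g c =
    sym (*-distribʳ-+ c (ΣSub es (λ F → g (e ∷ F))) (ΣSub es g))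

  ΣSub-*ˡ : ∀ es (g : List A → ℕ) c → ΣSub es (λ F → c * g F) ≡ c * ΣSub es g
  ΣSub-*ˡ []       g c = refl
  ΣSub-*ˡ (e ∷ es) g c rewrite ΣSub-*ˡ es (λ F → g (e ∷ F)) c | ΣSub-*ˡ es g c =
    sym (*-distribˡ-+ c (ΣSub es (λ F → g (e ∷ F))) (ΣSub es g))

  ΣSub-bilinear : ∀ xs ys (f h g k : List A → ℕ) →
    ΣSub xs (λ F₁ → ΣSub ys (λ F₂ → f F₁ * g F₂ + h F₁ * k F₂)) ≡ ΣSub xs f * ΣSub ys g + ΣSub xs h * ΣSub ys k
  ΣSub-bilinear xs ys f h g k = begin
    ΣSub xs (λ F₁ → ΣSub ys (λ F₂ → f F₁ * g F₂ + h F₁ * k F₂))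
      ≡⟨ ΣSub-cong xs (λ F₁ → trans (ΣSub-+ ys _ _) (cong₂ _+_ (ΣSub-*ˡ ys g (f F₁)) (ΣSub-*ˡ ys k (h F₁)))) ⟩
    ΣSub xs (λ F₁ → f F₁ * ΣSub ys g + h F₁ * ΣSub ys k)
      ≡⟨ trans (ΣSub-+ xs _ _) (cong₂ _+_ (ΣSub-*ʳ xs f (ΣSub ys g)) (ΣSub-*ʳ xs h (ΣSub ys k))) ⟩
    ΣSub xs f * ΣSub ys g + ΣSub xs h * ΣSub ys k ∎
    where open ≡-Reasoning

  ΣSub-filter : ∀ (p : A → Bool) es (h : List A → ℕ) →
                ΣSub es (λ F → ind (all p F) * h F) ≡ ΣSub (filterᵇ p es) h
  ΣSub-filter p []       h = +-identityʳ (h [])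
  ΣSub-filter p (e ∷ es) h with p e
  ... | true  = cong₂ _+_ (ΣSub-filter p es (λ F → h (e ∷ F))) (ΣSub-filter p es h)
  ... | false = trans (cong (_+ ΣSub es (λ F → ind (all p F) * h F)) (ΣSub-zero es)) (ΣSub-filter p es h)

  ΣSub-↭ : ∀ {xs ys} → xs ↭ ys → (g : List A → ℕ) → (∀ {F F'} → F ↭ F' → g F ≡ g F') → ΣSub xs g ≡ ΣSub ys g
  ΣSub-↭ Perm.refl g inv = refl
  ΣSub-↭ (prep x p) g inv =
    cong₂ _+_ (ΣSub-↭ p (λ F → g (x ∷ F)) (λ q → inv (prep x q))) (ΣSub-↭ p g inv)
  ΣSub-↭ {x ∷ y ∷ xs} {y ∷ x ∷ ys} (swap x y p) g inv = begin
    ΣSub xs (λ F → g (x ∷ y ∷ F)) + ΣSub xs (λ F → g (x ∷ F)) + (ΣSub xs (λ F → g (y ∷ F)) + ΣSub xs g)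
      ≡⟨ cong₂ _+_ (cong₂ _+_ xy-part (ΣSub-↭ p _ (λ q → inv (prep x q))))
                   (cong₂ _+_ (ΣSub-↭ p _ (λ q → inv (prep y q))) (ΣSub-↭ p g inv)) ⟩
    ΣSub ys (λ F → g (y ∷ x ∷ F)) + ΣSub ys (λ F → g (x ∷ F)) + (ΣSub ys (λ F → g (y ∷ F)) + ΣSub ys g)
      ≡⟨ interchange (ΣSub ys (λ F → g (y ∷ x ∷ F))) (ΣSub ys (λ F → g (x ∷ F))) (ΣSub ys (λ F → g (y ∷ F))) (ΣSub ys g) ⟩
    ΣSub ys (λ F → g (y ∷ x ∷ F)) + ΣSub ys (λ F → g (y ∷ F)) + (ΣSub ys (λ F → g (x ∷ F)) + ΣSub ys g) ∎
    where
    open ≡-Reasoning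
    xy-part : ΣSub xs (λ F → g (x ∷ y ∷ F)) ≡ ΣSub ys (λ F → g (y ∷ x ∷ F))
    xy-part = trans (ΣSub-↭ p (λ F → g (x ∷ y ∷ F)) (λ q → inv (prep x (prep y q))))
                    (ΣSub-cong ys (λ F → inv (swap x y Perm.refl)))
  ΣSub-↭ (Perm.trans p q) g inv = trans (ΣSub-↭ p g inv) (ΣSub-↭ q g inv)

ΣSub-map : ∀ {A B : Set} (r : A → B) es (h : List B → ℕ) → ΣSub (map r es) h ≡ ΣSub es (λ F → h (map r F))
ΣSub-map r []       h = refl
ΣSub-map r (e ∷ es) h = cong₂ _+_ (ΣSub-map r es (λ F → h (r e ∷ F))) (ΣSub-map r es h)

-- A walk
-- along Fa ++ Fb can only change sides at i or j, so, seen from side a, each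
-- excursion into side b is a walk in Fb between i and j; it may be replaced by
-- a virtual edge ij.

module Separation {n : ℕ} (i j : Fin n) (i≢j : i ≢ j) where

  IJ : Fin n → Set
  IJ x = x ≡ i ⊎ x ≡ j

  ij : Edge n
  ij = i , j

  SideWalk : List (Edge n) → List (Edge n) → Fin n → Fin n → Set
  SideWalk Fa Fb c b = Walk Fa c b ⊎ (Walk Fb i j × Walk (ij ∷ Fa) c b)

  module Sides (Va Vb : Fin n → Bool) (Fa Fb : List (Edge n))
               (within-a : Within Va Fa) (within-b : Within Vb Fb)
               (shared : ∀ x → Va x ≡ true → Vb x ≡ true → IJ x) where

    SideWalk-trans : ∀ {a b c} → SideWalk Fa Fb a b → SideWalk Fa Fb b c → SideWalk Fa Fb a c
    SideWalk-trans (inj₁ r)       (inj₁ s)       = inj₁ (Walk-trans r s)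
    SideWalk-trans (inj₁ r)       (inj₂ (t , s)) = inj₂ (t , Walk-trans (Walk-mono there r) s)
    SideWalk-trans (inj₂ (t , r)) (inj₁ s)       = inj₂ (t , Walk-trans r (Walk-mono there s))
    SideWalk-trans (inj₂ (t , r)) (inj₂ (_ , s)) = inj₂ (t , Walk-trans r s)

    excursion : ∀ {a k} → IJ a → IJ k → Walk Fb a k → SideWalk Fa Fb a k
    excursion (inj₁ refl) (inj₁ refl) _ = inj₁ nil
    excursion (inj₁ refl) (inj₂ refl) r = inj₂ (r , edgeWalk (here refl) forward)
    excursion (inj₂ refl) (inj₁ refl) r = inj₂ (Walk-sym r , edgeWalk (here refl) (Joins-sym forward))
    excursion (inj₂ refl) (inj₂ refl) _ = inj₁ nil

    -- the invariant of a walk ending at b ∈ Va, read backwards: from a start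
    -- c ∈ Va it is a side walk; from c ∈ Vb it first reaches i or j in Fb
    Crossing : Fin n → Fin n → Set
    Crossing c b = (Va c ≡ true → SideWalk Fa Fb c b)
                 × (Vb c ≡ true → Σ (Fin n) λ k → IJ k × Walk Fb c k × SideWalk Fa Fb k b)

    crossing : ∀ {R c b} → R ⊆ Fa ++ Fb → Walk R c b → Va b ≡ true → Crossing c b
    crossing {b = b} _ nil vb = (λ _ → inj₁ nil) , (λ wb → b , shared b vb wb , nil , inj₁ nil)
    crossing sub (cons e m ad w) vb with crossing sub w vb | ∈-++⁻ Fa (sub m)
    ... | (fa , fb) | inj₁ ma =
      let rest = SideWalk-trans (inj₁ (edgeWalk ma ad)) (fa (Joins-within (within-a ma) (Joins-sym ad)))
      in (λ _ → rest) , (λ wc → _ , shared _ (Joins-within (within-a ma) ad) wc , nil , rest)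
    ... | (fa , fb) | inj₂ mb with fb (Joins-within (within-b mb) (Joins-sym ad))
    ... | k , ijk , r , p =
      (λ vc → SideWalk-trans (excursion (shared _ vc (Joins-within (within-b mb) ad)) ijk
                                        (Walk-trans (edgeWalk mb ad) r)) p) ,
      (λ _ → k , ijk , Walk-trans (edgeWalk mb ad) r , p)

  -- the parts of a forest F1 ++ F2 are forests, and they cannot both join i
  -- and j, since together with a walk in the other part this closes a cycle
  Forest-++⁻ : ∀ F1 F2 → Forest (F1 ++ F2) → Forest F1 × Forest F2 × ¬ (Walk F1 i j × Walk F2 i j)
  Forest-++⁻ []       F2 a = tt , a , λ (r , _) → i≢j (Walk-[] r)
  Forest-++⁻ (x ∷ F1) F2 (nx , a) with Forest-++⁻ F1 F2 a
  ... | a1 , a2 , nij = ((λ r → nx (Walk-mono inˡ r)) , a1) , a2 , nij'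
    where
    inˡ : F1 ⊆ F1 ++ F2
    inˡ = xs⊆xs++ys F1 F2
    inʳ : F2 ⊆ F1 ++ F2
    inʳ = xs⊆ys++xs F2 F1
    nij' : ¬ (Walk (x ∷ F1) i j × Walk F2 i j)
    nij' (r , t) with walk-cases r
    ... | inj₁ q              = nij (q , t)
    ... | inj₂ (inj₁ (p , q)) =
      nx (Walk-trans (Walk-mono inˡ (Walk-sym p)) (Walk-trans (Walk-mono inʳ t) (Walk-mono inˡ (Walk-sym q))))
    ... | inj₂ (inj₂ (p , q)) =
      nx (Walk-trans (Walk-mono inˡ q) (Walk-trans (Walk-mono inʳ (Walk-sym t)) (Walk-mono inˡ p)))

  module TwoSided (V₁ V₂ : Fin n → Bool) (shared : ∀ x → V₁ x ≡ true → V₂ x ≡ true → IJ x) where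

    module _ {F1 F2 : List (Edge n)} (within₁ : Within V₁ F1) (within₂ : Within V₂ F2) where

      inside : ∀ {a b} → V₁ a ≡ true → V₁ b ≡ true → Walk (F1 ++ F2) a b → SideWalk F1 F2 a b
      inside va vb r = proj₁ (Sides.crossing V₁ V₂ F1 F2 within₁ within₂ shared (λ m → m) r vb) va

      enter₂ : ∀ {a y} → V₁ a ≡ true → V₂ y ≡ true → Walk (F1 ++ F2) a y → Walk F2 i y ⊎ Walk F2 j y
      enter₂ va vy r with proj₂ (Sides.crossing V₂ V₁ F2 F1 within₂ within₁ (λ x p q → shared x q p)
                                   (⊆-reflexive-↭ (++-comm F1 F2)) r vy) va
      ... | _ , k-ij , _ , s = fromSeparator k-ij s
        where
        fromSeparator : ∀ {k y} → IJ k → SideWalk F2 F1 k y → Walk F2 i y ⊎ Walk F2 j y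
        fromSeparator (inj₁ refl) (inj₁ s) = inj₁ s
        fromSeparator (inj₂ refl) (inj₁ s) = inj₂ s
        fromSeparator k-ij (inj₂ (_ , s)) with walk-cases s
        ... | inj₂ (inj₁ (_ , q)) = inj₂ q
        ... | inj₂ (inj₂ (_ , q)) = inj₁ q
        ... | inj₁ q with k-ij
        ...   | inj₁ refl = inj₁ q
        ...   | inj₂ refl = inj₂ q

    Forest-++⁺ : ∀ F1 F2 → Within V₁ F1 → Within V₂ F2 →
                 Forest F1 → Forest F2 → ¬ (Walk F1 i j × Walk F2 i j) → Forest (F1 ++ F2)
    Forest-++⁺ []       F2 _ _ _ a2 _ = a2
    Forest-++⁺ (x ∷ F1) F2 within₁ within₂ (nx , a1) a2 nij =
      bridge , Forest-++⁺ F1 F2 (λ m → within₁ (there m)) within₂ a1 a2 (λ (r , t) → nij (Walk-mono there r , t))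
      where
      bridge : ¬ Joined (F1 ++ F2) x
      bridge r with inside (λ m → within₁ (there m)) within₂
                           (proj₁ (within₁ (here refl))) (proj₂ (within₁ (here refl))) r
      ... | inj₁ q       = nx q
      ... | inj₂ (t , q) = nij (exchange nx q , t)

  merge : Edge n → Edge n
  merge e = ren i j (proj₁ e) , ren i j (proj₂ e)

  ren-j : ren i j j ≡ i
  ren-j rewrite ≡⇒== {x = j} refl = refl

  ren-≢ : ∀ {x} → x ≢ j → ren i j x ≡ x
  ren-≢ {x} ne rewrite ≢⇒== ne = refl

  ren-i : ren i j i ≡ i
  ren-i = ren-≢ i≢j

  ren≢j : ∀ x → ren i j x ≢ j
  ren≢j x with x ≟ j
  ... | yes _ = i≢j
  ... | no ne = ne

  ren-cases : ∀ x → ren i j x ≡ i ⊎ ren i j x ≡ x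
  ren-cases x with x ≟ j
  ... | yes _ = inj₁ refl
  ... | no _  = inj₂ refl

  contract-walk : ∀ {F a b} → Walk (ij ∷ F) a b → Walk (map merge F) (ren i j a) (ren i j b)
  contract-walk nil = nil
  contract-walk {F} {b = b} (cons e (here refl) (inj₁ (refl , refl)) w) =
    subst (λ z → Walk (map merge F) z (ren i j b)) (trans ren-j (sym ren-i)) (contract-walk w)
  contract-walk {F} {b = b} (cons e (here refl) (inj₂ (refl , refl)) w) =
    subst (λ z → Walk (map merge F) z (ren i j b)) (trans ren-i (sym ren-j)) (contract-walk w)
  contract-walk (cons e (there m) (inj₁ (refl , refl)) w) =
    cons (merge e) (∈-map⁺ merge m) (inj₁ (refl , refl)) (contract-walk w)
  contract-walk (cons e (there m) (inj₂ (refl , refl)) w) =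
    cons (merge e) (∈-map⁺ merge m) (inj₂ (refl , refl)) (contract-walk w)

  same-ren : ∀ {F a b} → ren i j a ≡ ren i j b → Walk (ij ∷ F) a b
  same-ren {F} {a} {b} e with a ≟ j | b ≟ j
  ... | yes pa | yes pb = subst (Walk (ij ∷ F) a) (trans pa (sym pb)) nil
  ... | yes pa | no _   = subst (λ z → Walk (ij ∷ F) z b) (sym pa)
                            (subst (Walk (ij ∷ F) j) e (edgeWalk (here refl) (Joins-sym forward)))
  ... | no _   | yes pb = subst (Walk (ij ∷ F) a) (sym pb)
                            (subst (λ z → Walk (ij ∷ F) z j) (sym e) (edgeWalk (here refl) forward))
  ... | no _   | no _   = subst (Walk (ij ∷ F) a) e nil

  lift-walk : ∀ {F x y} → Walk (map merge F) x y → ∀ a b → ren i j a ≡ x → ren i j b ≡ y → Walk (ij ∷ F) a b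
  lift-walk nil a b p q = same-ren (trans p (sym q))
  lift-walk (cons _ m ad w) a b p q with ∈-map⁻ merge m
  lift-walk (cons _ m (inj₁ (p₁ , p₂)) w) a b p q | e , me , refl =
    Walk-trans (same-ren (trans p (sym p₁))) (Walk-trans (edgeWalk (there me) forward) (lift-walk w (proj₂ e) b p₂ q))
  lift-walk (cons _ m (inj₂ (p₁ , p₂)) w) a b p q | e , me , refl =
    Walk-trans (same-ren (trans p (sym p₁)))
      (Walk-trans (edgeWalk (there me) (Joins-sym forward)) (lift-walk w (proj₁ e) b p₂ q))

  Forest-merge⁻ : ∀ F → Forest (map merge F) → ¬ Joined F ij × Forest F
  Forest-merge⁻ []       _        = (λ r → i≢j (Walk-[] r)) , tt
  Forest-merge⁻ (x ∷ F) (nx , a) with Forest-merge⁻ F a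
  ... | nij , a1 = (λ r → nx' (exchange nij r)) , (λ r → nx' (Walk-mono there r)) , a1
    where
    nx' : ¬ Joined (ij ∷ F) x
    nx' r = nx (contract-walk r)

  Forest-merge⁺ : ∀ F → ¬ Joined F ij → Forest F → Forest (map merge F)
  Forest-merge⁺ []      _   _         = tt
  Forest-merge⁺ (x ∷ F) nij (nx , a1) =
    (λ r → nij (exchange nx (lift-walk r (proj₁ x) (proj₂ x) refl refl))) ,
    Forest-merge⁺ F (λ r → nij (Walk-mono there r)) a1

  -- the edges kept by 'contract': those not joining i and j
  notIJ : Edge n → Bool
  notIJ e = not (((proj₁ e == i) ∧ (proj₂ e == j)) ∨ ((proj₁ e == j) ∧ (proj₂ e == i)))

  all-notIJ : ∀ {F} → ¬ Walk F i j → all notIJ F ≡ true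
  all-notIJ {F} i≁j = all-intro notIJ F (λ {e} m → not-intro (λ q → i≁j (edgeWalk m (joins-ij e q))))
    where
    joins-ij : ∀ e → (((proj₁ e == i) ∧ (proj₂ e == j)) ∨ ((proj₁ e == j) ∧ (proj₂ e == i))) ≡ true → Joins e i j
    joins-ij e q with ∨-elim {(proj₁ e == i) ∧ (proj₂ e == j)} q
    ... | inj₁ r = inj₁ (==⇒≡ (proj₁ (∧-elim r)) , ==⇒≡ (proj₂ (∧-elim {proj₁ e == i} r)))
    ... | inj₂ r = inj₂ (==⇒≡ (proj₂ (∧-elim {proj₁ e == j} r)) , ==⇒≡ (proj₁ (∧-elim r)))

  count-contract : ∀ (H : Graph n) (Q : List (Edge n) → Bool) →
    count (length (E (contract H i j))) (λ bs → Q (select (E (contract H i j)) bs))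
    ≡ ΣSub (E H) (λ F → ind (all notIJ F) * ind (Q (map merge F)))
  count-contract H Q = begin
    count (length (E (contract H i j))) (λ bs → Q (select (E (contract H i j)) bs))
      ≡⟨ count-ΣSub (map merge (filterᵇ notIJ (E H))) Q ⟩
    ΣSub (map merge (filterᵇ notIJ (E H))) (λ F → ind (Q F))
      ≡⟨ ΣSub-map merge (filterᵇ notIJ (E H)) (λ F → ind (Q F)) ⟩
    ΣSub (filterᵇ notIJ (E H)) (λ F → ind (Q (map merge F)))
      ≡⟨ sym (ΣSub-filter notIJ (E H) (λ F → ind (Q (map merge F)))) ⟩
    ΣSub (E H) (λ F → ind (all notIJ F) * ind (Q (map merge F))) ∎
    where open ≡-Reasoning

module Decomposition {n : ℕ} (V₁ V₂ : Fin n → Bool) (i j u v : Fin n) (i≢j : i ≢ j)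
  (vi₁ : V₁ i ≡ true) (vi₂ : V₂ i ≡ true) (vj₁ : V₁ j ≡ true) (vj₂ : V₂ j ≡ true)
  (shared : ∀ x → V₁ x ≡ true → V₂ x ≡ true → x ≡ i ⊎ x ≡ j)
  (covers : ∀ x → V₁ x ∨ V₂ x ≡ true) (vu : V₁ u ≡ true) (vv : V₁ v ≡ true)
  {F1 F2 : List (Edge n)} (within₁ : Within V₁ F1) (within₂ : Within V₂ F2) where

  open Separation i j i≢j
  open TwoSided V₁ V₂ shared

  Vc : Fin n → Bool
  Vc x = V₁ x ∧ not (x == j)

  inˡ : F1 ⊆ F1 ++ F2
  inˡ = xs⊆xs++ys F1 F2

  inʳ : F2 ⊆ F1 ++ F2
  inʳ = xs⊆ys++xs F2 F1

  TwoForestG SplitForests TreeAndContraction : Set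
  TwoForestG         = TwoForest (λ _ → true) (F1 ++ F2) u v
  SplitForests       = TwoForest V₁ F1 u v × TwoForest V₂ F2 i j
  TreeAndContraction = TwoForest Vc (map merge F1) (ren i j u) (ren i j v) × SpanningTree V₂ F2

  joins-ij? : Walk F2 i j ⊎ ¬ Walk F2 i j
  joins-ij? with conn F2 i j in eq
  ... | true  = inj₁ (conn-sound F2 i eq)
  ... | false = inj₂ (λ r → false≢true (trans (sym eq) (conn-complete F2 i r)))
    where
    false≢true : false ≡ true → ⊥
    false≢true ()

  Reached : Fin n → Set
  Reached x = Walk (F1 ++ F2) u x ⊎ Walk (F1 ++ F2) v x

  extend₂ : ∀ {k x} → Reached k → Walk F2 k x → Reached x
  extend₂ r s = ⊎-map (λ p → Walk-trans p (Walk-mono inʳ s)) (λ p → Walk-trans p (Walk-mono inʳ s)) r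

  restrict-split : TwoForestG → ¬ Walk F2 i j → SplitForests
  restrict-split (forest , u≁v , reach) i≁j =
    (forest₁ , (λ r → u≁v (Walk-mono inˡ r)) , reach₁) , (forest₂ , i≁j , reach₂)
    where
    forest₁ : Forest F1
    forest₁ = proj₁ (Forest-++⁻ F1 F2 forest)
    forest₂ : Forest F2
    forest₂ = proj₁ (proj₂ (Forest-++⁻ F1 F2 forest))
    onSide₁ : ∀ {a x} → V₁ a ≡ true → V₁ x ≡ true → Walk (F1 ++ F2) a x → Walk F1 a x
    onSide₁ va vx r with inside within₁ within₂ va vx r
    ... | inj₁ q       = q
    ... | inj₂ (t , _) = ⊥-elim (i≁j t)
    reach₁ : ∀ x → V₁ x ≡ true → Walk F1 u x ⊎ Walk F1 v x
    reach₁ x vx = ⊎-map (onSide₁ vu vx) (onSide₁ vv vx) (reach x refl)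
    reach₂ : ∀ y → V₂ y ≡ true → Walk F2 i y ⊎ Walk F2 j y
    reach₂ y vy with reach y refl
    ... | inj₁ r = enter₂ within₁ within₂ vu vy r
    ... | inj₂ r = enter₂ within₁ within₂ vv vy r

  restrict-tree : TwoForestG → Walk F2 i j → ¬ Walk F1 i j × TreeAndContraction
  restrict-tree (forest , u≁v , reach) i~j =
    i≁j₁ , (Forest-merge⁺ F1 i≁j₁ forest₁ , u≁vc , reachc) , (forest₂ , connected)
    where
    forest₁ : Forest F1
    forest₁ = proj₁ (Forest-++⁻ F1 F2 forest)
    forest₂ : Forest F2
    forest₂ = proj₁ (proj₂ (Forest-++⁻ F1 F2 forest))
    i≁j₁ : ¬ Walk F1 i j
    i≁j₁ r = proj₂ (proj₂ (Forest-++⁻ F1 F2 forest)) (r , i~j)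
    u≁vc : ¬ Walk (map merge F1) (ren i j u) (ren i j v)
    u≁vc r = u≁v (bypass (lift-walk r u v refl refl) (Walk-mono inʳ i~j) inˡ)
    toContraction : ∀ {a x} → V₁ a ≡ true → V₁ x ≡ true → Walk (F1 ++ F2) a x →
                    Walk (map merge F1) (ren i j a) (ren i j x)
    toContraction va vx r with inside within₁ within₂ va vx r
    ... | inj₁ q       = contract-walk (Walk-mono there q)
    ... | inj₂ (_ , q) = contract-walk q
    reachc : ∀ x → Vc x ≡ true → Walk (map merge F1) (ren i j u) x ⊎ Walk (map merge F1) (ren i j v) x
    reachc x vcx with ∧-elim {V₁ x} vcx
    ... | vx , x≢j = ⊎-map (fix ∘′ toContraction vu vx) (fix ∘′ toContraction vv vx) (reach x refl)
      where
      fix : ∀ {a} → Walk (map merge F1) a (ren i j x) → Walk (map merge F1) a x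
      fix = subst (Walk _ _) (ren-≢ (λ e → not-elim x≢j (≡⇒== e)))
    fromI : ∀ y → V₂ y ≡ true → Walk F2 i y
    fromI y vy with reach y refl
    ... | inj₁ r = [ id , Walk-trans i~j ]′ (enter₂ within₁ within₂ vu vy r)
    ... | inj₂ r = [ id , Walk-trans i~j ]′ (enter₂ within₁ within₂ vv vy r)
    connected : ∀ x y → V₂ x ≡ true → V₂ y ≡ true → Walk F2 x y
    connected x y vx vy = Walk-trans (Walk-sym (fromI x vx)) (fromI y vy)

  decompose : TwoForestG → SplitForests ⊎ (¬ Walk F1 i j × TreeAndContraction)
  decompose t = [ inj₂ ∘′ restrict-tree t , inj₁ ∘′ restrict-split t ]′ joins-ij?

  glue-split : SplitForests → TwoForestG
  glue-split ((forest₁ , u≁v₁ , reach₁) , (forest₂ , i≁j₂ , reach₂)) =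
    Forest-++⁺ F1 F2 within₁ within₂ forest₁ forest₂ (λ (_ , t) → i≁j₂ t) , u≁v , reach
    where
    u≁v : ¬ Walk (F1 ++ F2) u v
    u≁v r with inside within₁ within₂ vu vv r
    ... | inj₁ q       = u≁v₁ q
    ... | inj₂ (t , _) = i≁j₂ t
    reach : ∀ x → true ≡ true → Reached x
    reach x _ with ∨-elim {V₁ x} (covers x)
    ... | inj₁ vx = ⊎-map (Walk-mono inˡ) (Walk-mono inˡ) (reach₁ x vx)
    ... | inj₂ vx with reach₂ x vx
    ... | inj₁ s = extend₂ (⊎-map (Walk-mono inˡ) (Walk-mono inˡ) (reach₁ i vi₁)) s
    ... | inj₂ s = extend₂ (⊎-map (Walk-mono inˡ) (Walk-mono inˡ) (reach₁ j vj₁)) s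

  glue-tree : TreeAndContraction → TwoForestG
  glue-tree ((forestc , u≁vc , reachc) , (forest₂ , connected)) =
    Forest-++⁺ F1 F2 within₁ within₂ forest₁ forest₂ (λ (r , _) → i≁j₁ r) , u≁v , reach
    where
    i~j : Walk F2 i j
    i~j = connected i j vi₂ vj₂
    i≁j₁ : ¬ Walk F1 i j
    i≁j₁ = proj₁ (Forest-merge⁻ F1 forestc)
    forest₁ : Forest F1
    forest₁ = proj₂ (Forest-merge⁻ F1 forestc)
    u≁v : ¬ Walk (F1 ++ F2) u v
    u≁v r with inside within₁ within₂ vu vv r
    ... | inj₁ q       = u≁vc (contract-walk (Walk-mono there q))
    ... | inj₂ (_ , q) = u≁vc (contract-walk q)
    inVc : ∀ x → V₁ x ≡ true → Vc (ren i j x) ≡ true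
    inVc x vx = ∧-intro (V₁-ren (ren-cases x)) (not-intro (λ e → ren≢j x (==⇒≡ e)))
      where
      V₁-ren : ren i j x ≡ i ⊎ ren i j x ≡ x → V₁ (ren i j x) ≡ true
      V₁-ren (inj₁ e) = subst (λ z → V₁ z ≡ true) (sym e) vi₁
      V₁-ren (inj₂ e) = subst (λ z → V₁ z ≡ true) (sym e) vx
    reach₁ : ∀ x → V₁ x ≡ true → Reached x
    reach₁ x vx = ⊎-map (λ r → bypass (lift-walk r u x refl refl) (Walk-mono inʳ i~j) inˡ)
                        (λ r → bypass (lift-walk r v x refl refl) (Walk-mono inʳ i~j) inˡ)
                        (reachc (ren i j x) (inVc x vx))
    reach : ∀ x → true ≡ true → Reached x
    reach x _ with ∨-elim {V₁ x} (covers x)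
    ... | inj₁ vx = reach₁ x vx
    ... | inj₂ vx = extend₂ (reach₁ i vi₁) (connected i x vi₂ vx)

  -- The decomposition as an identity of Boolean predicates; the edge lists of
  -- the graphs are irrelevant here, only their vertex sets matter.
  decomposition : ∀ E E₁ E₂ →
    isTwoForestSep (mkGraph (λ _ → true) E) u v (F1 ++ F2)
    ≡ (isTwoForestSep (mkGraph V₁ E₁) u v F1 ∧ isTwoForestSep (mkGraph V₂ E₂) i j F2)
      ∨ ((all notIJ F1 ∧ isTwoForestSep (contract (mkGraph V₁ E₁) i j) (ren i j u) (ren i j v) (map merge F1))
         ∧ isSpanningTree (mkGraph V₂ E₂) F2)
  decomposition E E₁ E₂ = bool-ext to from
    where
    G₁ G₂ : Graph n
    G₁ = mkGraph V₁ E₁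
    G₂ = mkGraph V₂ E₂
    tfG tf₁ tf₂ tfc st₂ : Bool
    tfG = isTwoForestSep (mkGraph (λ _ → true) E) u v (F1 ++ F2)
    tf₁ = isTwoForestSep G₁ u v F1
    tf₂ = isTwoForestSep G₂ i j F2
    tfc = isTwoForestSep (contract G₁ i j) (ren i j u) (ren i j v) (map merge F1)
    st₂ = isSpanningTree G₂ F2
    to : tfG ≡ true → (tf₁ ∧ tf₂) ∨ ((all notIJ F1 ∧ tfc) ∧ st₂) ≡ true
    to p with decompose (twoForest-sound (mkGraph (λ _ → true) E) u v (F1 ++ F2) p)
    ... | inj₁ (t₁ , t₂)         =
      ∨-introˡ (∧-intro (twoForest-complete G₁ u v F1 t₁) (twoForest-complete G₂ i j F2 t₂))
    ... | inj₂ (i≁j , (tc , st)) = ∨-introʳ {tf₁ ∧ tf₂}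
      (∧-intro (∧-intro (all-notIJ i≁j) (twoForest-complete (contract G₁ i j) _ _ (map merge F1) tc))
               (spanningTree-complete G₂ F2 st))
    from : (tf₁ ∧ tf₂) ∨ ((all notIJ F1 ∧ tfc) ∧ st₂) ≡ true → tfG ≡ true
    from p = twoForest-complete (mkGraph (λ _ → true) E) u v (F1 ++ F2) (glue (∨-elim {tf₁ ∧ tf₂} p))
      where
      glue : (tf₁ ∧ tf₂) ≡ true ⊎ ((all notIJ F1 ∧ tfc) ∧ st₂) ≡ true → TwoForestG
      glue (inj₁ q) with ∧-elim q
      ... | q₁ , q₂ = glue-split (twoForest-sound G₁ u v F1 q₁ , twoForest-sound G₂ i j F2 q₂)
      glue (inj₂ q) with ∧-elim q
      ... | c , s = glue-tree (twoForest-sound (contract G₁ i j) _ _ (map merge F1) (proj₂ (∧-elim {all notIJ F1} c)) ,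
                               spanningTree-sound G₂ F2 s)

module Counting {n : ℕ} (E E₁ E₂ : List (Edge n)) (V₁ V₂ : Fin n → Bool) (i j u v : Fin n) (i≢j : i ≢ j)
  (vi₁ : V₁ i ≡ true) (vi₂ : V₂ i ≡ true) (vj₁ : V₁ j ≡ true) (vj₂ : V₂ j ≡ true)
  (shared : ∀ x → V₁ x ≡ true → V₂ x ≡ true → x ≡ i ⊎ x ≡ j)
  (covers : ∀ x → V₁ x ∨ V₂ x ≡ true) (vu : V₁ u ≡ true) (vv : V₁ v ≡ true) where

  open Separation i j i≢j using (merge; notIJ; count-contract)
  open ≡-Reasoning

  G G₁ G₂ Gc : Graph n
  G  = mkGraph (λ _ → true) E
  G₁ = mkGraph V₁ E₁
  G₂ = mkGraph V₂ E₂
  Gc = contract G₁ i j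

  tfG tf₁ tf₂ tfc st₂ : List (Edge n) → Bool
  tfG = isTwoForestSep G u v
  tf₁ = isTwoForestSep G₁ u v
  tf₂ = isTwoForestSep G₂ i j
  tfc = isTwoForestSep Gc (ren i j u) (ren i j v)
  st₂ = isSpanningTree G₂

  contracted : List (Edge n) → ℕ
  contracted F = ind (all notIJ F) * ind (tfc (map merge F))

  summand : ∀ {F1 F2} → Within V₁ F1 → Within V₂ F2 →
            ind (tfG (F1 ++ F2)) ≡ ind (tf₁ F1) * ind (tf₂ F2) + contracted F1 * ind (st₂ F2)
  summand {F1} {F2} w₁ w₂ = begin
    ind (tfG (F1 ++ F2))
      ≡⟨ cong ind (decomposition E E₁ E₂) ⟩
    ind ((tf₁ F1 ∧ tf₂ F2) ∨ ((all notIJ F1 ∧ tfc (map merge F1)) ∧ st₂ F2))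
      ≡⟨ ind-∨ disjoint ⟩
    ind (tf₁ F1 ∧ tf₂ F2) + ind ((all notIJ F1 ∧ tfc (map merge F1)) ∧ st₂ F2)
      ≡⟨ cong₂ _+_ (ind-∧ (tf₁ F1) (tf₂ F2))
                   (trans (ind-∧ (all notIJ F1 ∧ tfc (map merge F1)) (st₂ F2))
                          (cong (_* ind (st₂ F2)) (ind-∧ (all notIJ F1) (tfc (map merge F1))))) ⟩
    ind (tf₁ F1) * ind (tf₂ F2) + contracted F1 * ind (st₂ F2) ∎
    where
    open Decomposition V₁ V₂ i j u v i≢j vi₁ vi₂ vj₁ vj₂ shared covers vu vv w₁ w₂ using (decomposition)
    disjoint : tf₁ F1 ∧ tf₂ F2 ≡ true → (all notIJ F1 ∧ tfc (map merge F1)) ∧ st₂ F2 ≡ true → ⊥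
    disjoint p q = twoForest-not-tree vi₂ vj₂ (twoForest-sound G₂ i j F2 (proj₂ (∧-elim {tf₁ F1} p)))
                                              (spanningTree-sound G₂ F2 (proj₂ (∧-elim {all notIJ F1 ∧ tfc (map merge F1)} q)))

  split-count : All (λ e → V₁ (proj₁ e) ≡ true × V₁ (proj₂ e) ≡ true) E₁ →
                All (λ e → V₂ (proj₁ e) ≡ true × V₂ (proj₂ e) ≡ true) E₂ →
                ΣSub E₁ (λ F1 → ΣSub E₂ (λ F2 → ind (tfG (F1 ++ F2))))
                ≡ 𝓕 G₁ u v * 𝓕 G₂ i j + 𝓕 Gc (ren i j u) (ren i j v) * T G₂
  split-count all₁ all₂ = begin
    ΣSub E₁ (λ F1 → ΣSub E₂ (λ F2 → ind (tfG (F1 ++ F2))))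
      ≡⟨ ΣSub-congAll (λ F1 a₁ → ΣSub-congAll (λ F2 a₂ → summand (All.lookup a₁) (All.lookup a₂)) all₂) all₁ ⟩
    ΣSub E₁ (λ F1 → ΣSub E₂ (λ F2 → ind (tf₁ F1) * ind (tf₂ F2) + contracted F1 * ind (st₂ F2)))
      ≡⟨ ΣSub-bilinear E₁ E₂ (λ F → ind (tf₁ F)) contracted (λ F → ind (tf₂ F)) (λ F → ind (st₂ F)) ⟩
    ΣSub E₁ (λ F → ind (tf₁ F)) * ΣSub E₂ (λ F → ind (tf₂ F)) + ΣSub E₁ contracted * ΣSub E₂ (λ F → ind (st₂ F))
      ≡⟨ sym (cong₂ _+_ (cong₂ _*_ (count-ΣSub E₁ tf₁) (count-ΣSub E₂ tf₂))
                        (cong₂ _*_ (count-contract G₁ tfc) (count-ΣSub E₂ st₂))) ⟩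
    𝓕 G₁ u v * 𝓕 G₂ i j + 𝓕 Gc (ren i j u) (ren i j v) * T G₂ ∎

theorem9 : (n : ℕ) (E E₁ E₂ : List (Edge n)) (V₁ V₂ : Fin n → Bool) (i j u v : Fin n)
    → All (λ e → proj₁ e ≢ proj₂ e) E
    → E ↭ E₁ ++ E₂
    → All (λ e → V₁ (proj₁ e) ≡ true × V₁ (proj₂ e) ≡ true) E₁
    → All (λ e → V₂ (proj₁ e) ≡ true × V₂ (proj₂ e) ≡ true) E₂
    → (∀ x → V₁ x ∨ V₂ x ≡ true)
    → i ≢ j
    → V₁ i ≡ true → V₂ i ≡ true → V₁ j ≡ true → V₂ j ≡ true
    → (∀ x → V₁ x ≡ true → V₂ x ≡ true → x ≡ i ⊎ x ≡ j)
    → V₁ u ≡ true → V₁ v ≡ true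
    → 𝓕 (mkGraph (λ _ → true) E) u v
      ≡ 𝓕 (mkGraph V₁ E₁) u v * 𝓕 (mkGraph V₂ E₂) i j
        + 𝓕 (contract (mkGraph V₁ E₁) i j) (ren i j u) (ren i j v) * T (mkGraph V₂ E₂)
theorem9 n E E₁ E₂ V₁ V₂ i j u v _ perm all₁ all₂ covers i≢j vi₁ vi₂ vj₁ vj₂ shared vu vv = begin
  𝓕 G u v
    ≡⟨ count-ΣSub E tfG ⟩
  ΣSub E (λ F → ind (tfG F))
    ≡⟨ ΣSub-↭ perm (λ F → ind (tfG F)) (λ p → cong ind (isTwoForestSep-↭ G u v p)) ⟩
  ΣSub (E₁ ++ E₂) (λ F → ind (tfG F))
    ≡⟨ ΣSub-++ E₁ E₂ (λ F → ind (tfG F)) ⟩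
  ΣSub E₁ (λ F1 → ΣSub E₂ (λ F2 → ind (tfG (F1 ++ F2))))
    ≡⟨ split-count all₁ all₂ ⟩
  𝓕 G₁ u v * 𝓕 G₂ i j + 𝓕 Gc (ren i j u) (ren i j v) * T G₂ ∎
  where
  open Counting E E₁ E₂ V₁ V₂ i j u v i≢j vi₁ vi₂ vj₁ vj₂ shared covers vu vv
  open ≡-Reasoning
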